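{- Let $\Omega$ be a set with $|\Omega|=n$, let $m\ge 1$, and let $A$ be the adjacency matrix of the incidence graph $J(n,m,m+1)$. Fix $x\in\binom{\Omega}{m}$ and, for $0\le i,j\le 2m+1$, let $A_{i,j}$ be the submatrix of $A$ with rows indexed by $\Gamma_i(x)$ and columns indexed by $\Gamma_j(x)$, where the vertices of $\Gamma_k(x)$ are identified with pairs as described in the context. Then (1) $A_{i,j}=0$ whenever $0\le i\le j\le 2m+1$ and $i\neq j-1$; (2) $A_{2i,2i+1}=I_{\binom{m}{m-i}}\otimes W_{i,i+1}(n-m)$ for $0\le i\le m$; (3) $A_{2i+1,2i+2}=\big(W_{m-i-1,m-i}(m)\big)^{t}\otimes I_{\binom{n-m}{i+1}}$ for $0\le i\le m-1$.
   Context: The incidence graph $J(n,m,m+1)$ of the Johnson geometry is the bipartite graph with vertex set $\binom{\Omega}{m}\cup\binom{\Omega}{m+1}$ (where $\binom{S}{k}$ denotes the set of $k$-subsets of $S$), in which $y\in\binom{\Omega}{m}$ and $z\in\binom{\Omega}{m+1}$ are adjacent iff $y\subseteq z$. For a vertex $x$, $\Gamma_k(x)$ is the set of vertices at graph distance $k$ from $x$. For $x\in\binom{\Omega}{m}$ one has $\Gamma_{2i}(x)=\{y\in\binom{\Omega}{m}: |x\cap y|=m-i\}$ and $\Gamma_{2i+1}(x)=\{z\in\binom{\Omega}{m+1}: |x\cap z|=m-i\}$. A vertex $y\in\Gamma_k(x)$ is identified with the pair $(y\cap x,\ y\setminus x)\in\binom{x}{m-\lfloor k/2\rfloor}\times\binom{\Omega\setminus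 x}{\lceil k/2\rceil}$, so matrices indexed by $\Gamma_k(x)\times\Gamma_l(x)$ are written as Kronecker products $P\otimes Q$ with $(P\otimes Q)_{(\alpha,\beta),(\alpha',\beta')}=P_{\alpha\alpha'}Q_{\beta\beta'}$, where $P$ is indexed by subsets of $x$ (a set of size $m$) and $Q$ by subsets of $\Omega\setminus x$ (a set of size $n-m$). For a set $V$ of size $v$, the inclusion matrix $W_{i,j}(v)$ is the $(0,1)$-matrix with rows indexed by $\binom{V}{i}$, columns by $\binom{V}{j}$, and $(y,z)$-entry $1$ iff $y\subseteq z$. $I_N$ denotes the $N\times N$ identity matrix; ${}^t$ denotes transpose. -}

module Defs where

open import Data.Nat using (ℕ; zero; suc; _<_)
open import Data.Nat.Properties using () renaming (_≟_ to _≟ℕ_)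
open import Data.Bool using (Bool; true; false; if_then_else_) renaming (_≟_ to _≟B_)
open import Data.Fin.Subset using (Subset; _⊆_; _∩_; _─_; ∣_∣)
open import Data.Fin.Subset.Properties using (_⊆?_)
open import Data.Vec.Properties using (≡-dec)
open import Data.Product using (_×_; _,_)
open import Data.Sum using (_⊎_)
open import Relation.Nullary using (¬_; Dec; does)
open import Relation.Nullary.Decidable using (_×-dec_; _⊎-dec_)
open import Relation.Binary.PropositionalEquality using (_≡_)

-- Ω = Fin n; a subset of Ω is a `Subset n`.

IsVertex : ∀ {n} (m : ℕ) → Subset n → Set
IsVertex m s = ∣ s ∣ ≡ m ⊎ ∣ s ∣ ≡ suc m

Adj : ∀ {n} (m : ℕ) → Subset n → Subset n → Set
Adj m y z = (∣ y ∣ ≡ m × ∣ z ∣ ≡ suc m × y ⊆ z)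
          ⊎ (∣ z ∣ ≡ m × ∣ y ∣ ≡ suc m × z ⊆ y)

Adj? : ∀ {n} (m : ℕ) (y z : Subset n) → Dec (Adj m y z)
Adj? m y z =
  ((∣ y ∣ ≟ℕ m) ×-dec ((∣ z ∣ ≟ℕ suc m) ×-dec (y ⊆? z)))
  ⊎-dec ((∣ z ∣ ≟ℕ m) ×-dec ((∣ y ∣ ≟ℕ suc m) ×-dec (z ⊆? y)))

-- Matrices with ℕ entries indexed by rows of type R and columns of type C
-- (only entries at the relevant index sets are ever used).
Mat : Set → Set → Set
Mat R C = R → C → ℕ

adjMat : ∀ {n} (m : ℕ) → Mat (Subset n) (Subset n)
adjMat m y z = if does (Adj? m y z) then 1 else 0

data Walk {n} (m : ℕ) : Subset n → Subset n → ℕ → Set where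
  here : ∀ {u} → IsVertex m u → Walk m u u 0
  step : ∀ {u v w k} → Adj m u v → Walk m v w k → Walk m u w (suc k)

Γ : ∀ {n} (m : ℕ) (k : ℕ) (x y : Subset n) → Set
Γ m k x y = Walk m x y k × (∀ j → j < k → ¬ Walk m x y j)

idMat : ∀ {n} → Mat (Subset n) (Subset n)
idMat α β = if does (≡-dec _≟B_ α β) then 1 else 0

-- Inclusion matrix W_{i,j}: (y,z)-entry 1 iff y ⊆ z (rows i-subsets, cols j-subsets).
inclMat : ∀ {n} → Mat (Subset n) (Subset n)
inclMat α β = if does (α ⊆? β) then 1 else 0

_ᵗ : ∀ {R C} → Mat R C → Mat C R
(M ᵗ) c r = M r c

_⊗_ : ∀ {R C R' C'} → Mat R C → Mat R' C' → Mat (R × R') (C × C')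
(P ⊗ Q) (a , b) (a' , b') = P a a' Data.Nat.* Q b b'
  where import Data.Nat

-- Identification of a vertex y ∈ Γ_k(x) with the pair (y ∩ x , y ∖ x).
ident : ∀ {n} → Subset n → Subset n → Subset n × Subset n
ident x y = (y ∩ x , y ─ x)

-- The distance in J(n, m, m+1) from an m-set x to a vertex v is the Hamming distance
-- |x △ v|: an edge adds or removes one element, so changes it by one, and from any v ≠ x
-- one gets a step closer by adding an element of x or removing one outside x.  Walks
-- from x alternate between m-sets and (m+1)-sets, so edges only join consecutive layers.
-- An edge y ⊂ z = y ∪ {a} from layer 2i to layer 2i+1 moves away from x, so a ∉ x:
-- y and z agree inside x and are nested outside x, which is the block I ⊗ W.  From
-- layer 2i+1 to layer 2i+2 the removed element lies in x, which gives Wᵗ ⊗ I.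
module Submission where

open import Defs
open import Data.Nat using (ℕ; zero; suc; _+_; _*_; _≤_; s≤s)
open import Data.Nat.Properties
  using (≤-refl; ≤-trans; ≤-antisym; ≤-reflexive; ≮⇒≥; ≤∧≢⇒<; m<1+n⇒m≤n; m≤n⇒m≤1+n; n≤1+n; n≮n;
         1+n≢0; 1+n≢n; m+1+n≢n; suc-injective; +-suc; +-comm; +-assoc; +-identityʳ; *-suc)
open import Data.Bool using (if_then_else_) renaming (_≟_ to _≟B_)
open import Data.Fin using (Fin)
open import Data.Fin.Subset using (Subset; inside; outside; _⊆_; _∈_; _∉_; _∩_; _─_; ∣_∣)
open import Data.Fin.Subset.Properties
  using (_∈?_; _⊆?_; drop-∷-⊆; out⊆; s⊆s; p⊆q⇒∣p∣≤∣q∣; ⊆-refl; ⊆-reflexive;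
         x∈p∩q⁺; x∈p∩q⁻; p∩q⊆p; p─q⊆p; x∈p∧x∉q⇒x∈p─q)
open import Data.Vec using ([]; _∷_; here; there)
open import Data.Vec.Properties using (≡-dec)
open import Data.Product using (_×_; _,_; proj₁; proj₂; ∃-syntax)
open import Data.Sum using (_⊎_; inj₁; inj₂; swap)
import Data.Sum as Sum
open import Data.Empty using (⊥-elim)
open import Function using (_∘_)
open import Function.Bundles using (_⇔_; mk⇔; Equivalence)
import Function.Properties.Equivalence as ⇔
open import Relation.Nullary using (¬_; Dec; yes; no; does)
open import Relation.Binary.PropositionalEquality
  using (_≡_; _≢_; refl; sym; trans; cong; subst; subst₂; module ≡-Reasoning)

private
  variable
    n : ℕ

m≡1+n⊎n≡1+m⇒m≤1+n : ∀ {m n} → m ≡ suc n ⊎ n ≡ suc m → m ≤ suc n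
m≡1+n⊎n≡1+m⇒m≤1+n (inj₁ refl) = ≤-refl
m≡1+n⊎n≡1+m⇒m≤1+n (inj₂ refl) = m≤n⇒m≤1+n (n≤1+n _)

p⊆q∧∣p∣≡∣q∣⇒p≡q : (p q : Subset n) → p ⊆ q → ∣ p ∣ ≡ ∣ q ∣ → p ≡ q
p⊆q∧∣p∣≡∣q∣⇒p≡q [] [] _ _ = refl
p⊆q∧∣p∣≡∣q∣⇒p≡q (inside ∷ p) (inside ∷ q) p⊆q e =
  cong (inside ∷_) (p⊆q∧∣p∣≡∣q∣⇒p≡q p q (drop-∷-⊆ p⊆q) (suc-injective e))
p⊆q∧∣p∣≡∣q∣⇒p≡q (outside ∷ p) (outside ∷ q) p⊆q e =
  cong (outside ∷_) (p⊆q∧∣p∣≡∣q∣⇒p≡q p q (drop-∷-⊆ p⊆q) e)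
p⊆q∧∣p∣≡∣q∣⇒p≡q (inside ∷ p) (outside ∷ q) p⊆q e with p⊆q here
... | ()
p⊆q∧∣p∣≡∣q∣⇒p≡q (outside ∷ p) (inside ∷ q) p⊆q e =
  ⊥-elim (n≮n ∣ q ∣ (subst (_≤ ∣ q ∣) e (p⊆q⇒∣p∣≤∣q∣ (drop-∷-⊆ p⊆q))))

x∈p─q⇒x∉q : ∀ {x : Fin n} {p q} → x ∈ p ─ q → x ∉ q
x∈p─q⇒x∉q {p = _ ∷ _} {q = _ ∷ _} (there x∈p─q) (there x∈q) = x∈p─q⇒x∉q x∈p─q x∈q

p⊆q⇒p∩r⊆q∩r : (p q r : Subset n) → p ⊆ q → p ∩ r ⊆ q ∩ r
p⊆q⇒p∩r⊆q∩r p q r p⊆q x∈p∩r with x∈p∩q⁻ p r x∈p∩r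
... | x∈p , x∈r = x∈p∩q⁺ (p⊆q x∈p , x∈r)

p⊆q⇒p─r⊆q─r : (p q r : Subset n) → p ⊆ q → p ─ r ⊆ q ─ r
p⊆q⇒p─r⊆q─r p q r p⊆q x∈p─r = x∈p∧x∉q⇒x∈p─q (p⊆q (p─q⊆p p r x∈p─r)) (x∈p─q⇒x∉q x∈p─r)

p∩r⊆q∩r∧p─r⊆q─r⇒p⊆q : (p q r : Subset n) → p ∩ r ⊆ q ∩ r → p ─ r ⊆ q ─ r → p ⊆ q
p∩r⊆q∩r∧p─r⊆q─r⇒p⊆q p q r ∩⊆ ─⊆ {x} x∈p with x ∈? r
... | yes x∈r = p∩q⊆p q r (∩⊆ (x∈p∩q⁺ (x∈p , x∈r)))
... | no  x∉r = p─q⊆p q r (─⊆ (x∈p∧x∉q⇒x∈p─q x∈p x∉r))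

hamming : Subset n → Subset n → ℕ
hamming [] [] = 0
hamming (inside ∷ p) (inside ∷ q) = hamming p q
hamming (outside ∷ p) (outside ∷ q) = hamming p q
hamming (inside ∷ p) (outside ∷ q) = suc (hamming p q)
hamming (outside ∷ p) (inside ∷ q) = suc (hamming p q)

hamming-refl : (p : Subset n) → hamming p p ≡ 0
hamming-refl [] = refl
hamming-refl (inside ∷ p) = hamming-refl p
hamming-refl (outside ∷ p) = hamming-refl p

hamming-comm : (p q : Subset n) → hamming p q ≡ hamming q p
hamming-comm [] [] = refl
hamming-comm (inside ∷ p) (inside ∷ q) = hamming-comm p q
hamming-comm (outside ∷ p) (outside ∷ q) = hamming-comm p q
hamming-comm (inside ∷ p) (outside ∷ q) = cong suc (hamming-comm p q)
hamming-comm (outside ∷ p) (inside ∷ q) = cong suc (hamming-comm p q)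

hamming≡0⇒≡ : (p q : Subset n) → hamming p q ≡ 0 → p ≡ q
hamming≡0⇒≡ [] [] _ = refl
hamming≡0⇒≡ (inside ∷ p) (inside ∷ q) e = cong (inside ∷_) (hamming≡0⇒≡ p q e)
hamming≡0⇒≡ (outside ∷ p) (outside ∷ q) e = cong (outside ∷_) (hamming≡0⇒≡ p q e)

infix 4 _⋖_
_⋖_ : Subset n → Subset n → Set
p ⋖ q = p ⊆ q × ∣ q ∣ ≡ suc ∣ p ∣

⋖-split : (x p q : Subset n) → p ⋖ q →
  (p ∩ x ≡ q ∩ x × hamming x q ≡ suc (hamming x p)) ⊎
  (p ─ x ≡ q ─ x × hamming x p ≡ suc (hamming x q))
⋖-split x (inside ∷ p) (outside ∷ q) (p⊆q , _) with p⊆q here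
... | ()
⋖-split (b ∷ x) (outside ∷ p) (inside ∷ q) (p⊆q , e)
  with p⊆q∧∣p∣≡∣q∣⇒p≡q p q (drop-∷-⊆ p⊆q) (sym (suc-injective e))
⋖-split (outside ∷ x) (outside ∷ p) (inside ∷ p) _ | refl = inj₁ (refl , refl)
⋖-split (inside ∷ x) (outside ∷ p) (inside ∷ p) _ | refl = inj₂ (refl , refl)
⋖-split (b ∷ x) (inside ∷ p) (inside ∷ q) (p⊆q , e)
  with ⋖-split x p q (drop-∷-⊆ p⊆q , suc-injective e) | b
... | inj₁ (∩≡ , h) | inside  = inj₁ (cong (inside ∷_) ∩≡ , h)
... | inj₁ (∩≡ , h) | outside = inj₁ (cong (outside ∷_) ∩≡ , cong suc h)
... | inj₂ (─≡ , h) | inside  = inj₂ (cong (outside ∷_) ─≡ , h)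
... | inj₂ (─≡ , h) | outside = inj₂ (cong (inside ∷_) ─≡ , cong suc h)
⋖-split (b ∷ x) (outside ∷ p) (outside ∷ q) (p⊆q , e)
  with ⋖-split x p q (drop-∷-⊆ p⊆q , e) | b
... | inj₁ (∩≡ , h) | inside  = inj₁ (cong (outside ∷_) ∩≡ , cong suc h)
... | inj₁ (∩≡ , h) | outside = inj₁ (cong (outside ∷_) ∩≡ , h)
... | inj₂ (─≡ , h) | inside  = inj₂ (cong (outside ∷_) ─≡ , cong suc h)
... | inj₂ (─≡ , h) | outside = inj₂ (cong (outside ∷_) ─≡ , h)

grow-towards : (x p : Subset n) → x ⊆ p ⊎ ∃[ q ] (p ⋖ q × hamming x p ≡ suc (hamming x q))
grow-towards [] [] = inj₁ ⊆-refl
grow-towards (b ∷ x) (c ∷ p) with grow-towards x p | b | c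
... | inj₁ x⊆p | outside | _ = inj₁ (out⊆ x⊆p)
... | inj₁ x⊆p | inside | inside = inj₁ (s⊆s x⊆p)
... | inj₂ (q , (p⊆q , e) , h) | inside | inside = inj₂ (inside ∷ q , (s⊆s p⊆q , cong suc e) , h)
... | inj₂ (q , (p⊆q , e) , h) | outside | inside = inj₂ (inside ∷ q , (s⊆s p⊆q , cong suc e) , cong suc h)
... | inj₂ (q , (p⊆q , e) , h) | outside | outside = inj₂ (outside ∷ q , (s⊆s p⊆q , e) , h)
... | _ | inside | outside = inj₂ (inside ∷ p , (out⊆ ⊆-refl , refl) , refl)

shrink-towards : (x p : Subset n) → p ⊆ x ⊎ ∃[ q ] (q ⋖ p × hamming x p ≡ suc (hamming x q))
shrink-towards [] [] = inj₁ ⊆-refl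
shrink-towards (b ∷ x) (c ∷ p) with shrink-towards x p | b | c
... | _ | outside | inside = inj₂ (outside ∷ p , (out⊆ ⊆-refl , refl) , refl)
... | inj₁ p⊆x | _ | outside = inj₁ (out⊆ p⊆x)
... | inj₁ p⊆x | inside | inside = inj₁ (s⊆s p⊆x)
... | inj₂ (q , (q⊆p , e) , h) | inside | inside = inj₂ (inside ∷ q , (s⊆s q⊆p , cong suc e) , h)
... | inj₂ (q , (q⊆p , e) , h) | inside | outside = inj₂ (outside ∷ q , (s⊆s q⊆p , e) , cong suc h)
... | inj₂ (q , (q⊆p , e) , h) | outside | outside = inj₂ (outside ∷ q , (s⊆s q⊆p , e) , h)

⊆⇔∩≡×─⊆ : (x p q : Subset n) → ∣ q ∣ ≡ suc ∣ p ∣ → hamming x q ≡ suc (hamming x p) →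
  p ⊆ q ⇔ (p ∩ x ≡ q ∩ x × p ─ x ⊆ q ─ x)
⊆⇔∩≡×─⊆ x p q ∣q∣ h = mk⇔ to from
  where
  to : p ⊆ q → p ∩ x ≡ q ∩ x × p ─ x ⊆ q ─ x
  to p⊆q with ⋖-split x p q (p⊆q , ∣q∣)
  ... | inj₁ (∩≡ , _) = ∩≡ , p⊆q⇒p─r⊆q─r p q x p⊆q
  ... | inj₂ (_ , h′) = ⊥-elim (m+1+n≢n 1 (sym (trans h (cong suc h′))))
  from : p ∩ x ≡ q ∩ x × p ─ x ⊆ q ─ x → p ⊆ q
  from (∩≡ , ─⊆) = p∩r⊆q∩r∧p─r⊆q─r⇒p⊆q p q x (⊆-reflexive ∩≡) ─⊆

⊆⇔∩⊆×─≡ : (x p q : Subset n) → ∣ q ∣ ≡ suc ∣ p ∣ → hamming x p ≡ suc (hamming x q) →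
  p ⊆ q ⇔ (p ∩ x ⊆ q ∩ x × q ─ x ≡ p ─ x)
⊆⇔∩⊆×─≡ x p q ∣q∣ h = mk⇔ to from
  where
  to : p ⊆ q → p ∩ x ⊆ q ∩ x × q ─ x ≡ p ─ x
  to p⊆q with ⋖-split x p q (p⊆q , ∣q∣)
  ... | inj₁ (_ , h′) = ⊥-elim (m+1+n≢n 1 (sym (trans h (cong suc h′))))
  ... | inj₂ (─≡ , _) = p⊆q⇒p∩r⊆q∩r p q x p⊆q , sym ─≡
  from : p ∩ x ⊆ q ∩ x × q ─ x ≡ p ─ x → p ⊆ q
  from (∩⊆ , ─≡) = p∩r⊆q∩r∧p─r⊆q─r⇒p⊆q p q x ∩⊆ (⊆-reflexive (sym ─≡))

-- size of the far end of a walk of length k in J(n, m, m+1) starting at an m-set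
level : ℕ → ℕ → ℕ
level m zero = m
level m (suc zero) = suc m
level m (suc (suc k)) = level m k

level-2*+ : ∀ m i k → level m (2 * i + k) ≡ level m k
level-2*+ m zero k = refl
level-2*+ m (suc i) k = begin
  level m (2 * suc i + k)      ≡⟨ cong (level m ∘ (_+ k)) (*-suc 2 i) ⟩
  level m (2 + 2 * i + k)      ≡⟨ cong (level m) (+-assoc 2 (2 * i) k) ⟩
  level m (2 + (2 * i + k))    ≡⟨ level-2*+ m i k ⟩
  level m k                    ∎
  where open ≡-Reasoning

level-2* : ∀ m i → level m (2 * i) ≡ m
level-2* m i = trans (cong (level m) (sym (+-identityʳ (2 * i)))) (level-2*+ m i 0)

module _ {m : ℕ} where

  Adj⇒⋖⊎⋗ : {u v : Subset n} → Adj m u v → u ⋖ v ⊎ v ⋖ u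
  Adj⇒⋖⊎⋗ (inj₁ (∣u∣ , ∣v∣ , u⊆v)) = inj₁ (u⊆v , trans ∣v∣ (cong suc (sym ∣u∣)))
  Adj⇒⋖⊎⋗ (inj₂ (∣v∣ , ∣u∣ , v⊆u)) = inj₂ (v⊆u , trans ∣u∣ (cong suc (sym ∣v∣)))

  Adj⇒∣∣≢ : {u v : Subset n} → Adj m u v → ∣ u ∣ ≢ ∣ v ∣
  Adj⇒∣∣≢ (inj₁ (∣u∣ , ∣v∣ , _)) e = 1+n≢n (trans (sym ∣v∣) (trans (sym e) ∣u∣))
  Adj⇒∣∣≢ (inj₂ (∣v∣ , ∣u∣ , _)) e = 1+n≢n (trans (sym ∣u∣) (trans e ∣v∣))

  Adj⇔⊆ : {u v : Subset n} → ∣ u ∣ ≡ m → ∣ v ∣ ≡ suc m → Adj m u v ⇔ u ⊆ v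
  Adj⇔⊆ {u = u} {v = v} ∣u∣ ∣v∣ = mk⇔ to (λ u⊆v → inj₁ (∣u∣ , ∣v∣ , u⊆v))
    where
    to : Adj m u v → u ⊆ v
    to (inj₁ (_ , _ , u⊆v)) = u⊆v
    to (inj₂ (∣v∣′ , _ , _)) = ⊥-elim (1+n≢n (trans (sym ∣v∣) ∣v∣′))

  Adj⇔⊇ : {u v : Subset n} → ∣ u ∣ ≡ suc m → ∣ v ∣ ≡ m → Adj m u v ⇔ v ⊆ u
  Adj⇔⊇ {u = u} {v = v} ∣u∣ ∣v∣ = mk⇔ to (λ v⊆u → inj₂ (∣v∣ , ∣u∣ , v⊆u))
    where
    to : Adj m u v → v ⊆ u
    to (inj₁ (∣u∣′ , _ , _)) = ⊥-elim (1+n≢n (trans (sym ∣u∣) ∣u∣′))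
    to (inj₂ (_ , _ , v⊆u)) = v⊆u

  Adj⇒IsVertexʳ : {u v : Subset n} → Adj m u v → IsVertex m v
  Adj⇒IsVertexʳ (inj₁ (_ , ∣v∣ , _)) = inj₂ ∣v∣
  Adj⇒IsVertexʳ (inj₂ (∣v∣ , _ , _)) = inj₁ ∣v∣

  Walk⇒IsVertexʳ : ∀ {u v : Subset n} {k} → Walk m u v k → IsVertex m v
  Walk⇒IsVertexʳ (here v) = v
  Walk⇒IsVertexʳ (step _ walk) = Walk⇒IsVertexʳ walk

  Walk-snoc : ∀ {u v w : Subset n} {k} → Walk m u v k → Adj m v w → Walk m u w (suc k)
  Walk-snoc (here _) adj = step adj (here (Adj⇒IsVertexʳ adj))
  Walk-snoc (step adj′ walk) adj = step adj′ (Walk-snoc walk adj)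

  ∣∣-level : ∀ {u v : Subset n} {k} → Walk m u v k →
    (∣ u ∣ ≡ m → ∣ v ∣ ≡ level m k) × (∣ u ∣ ≡ suc m → ∣ v ∣ ≡ level m (suc k))
  ∣∣-level (here _) = (λ ∣u∣ → ∣u∣) , (λ ∣u∣ → ∣u∣)
  ∣∣-level (step (inj₁ (∣u∣ , ∣v∣ , _)) walk) =
    (λ _ → proj₂ (∣∣-level walk) ∣v∣) , (λ ∣u∣′ → ⊥-elim (1+n≢n (trans (sym ∣u∣′) ∣u∣)))
  ∣∣-level (step (inj₂ (∣v∣ , ∣u∣ , _)) walk) =
    (λ ∣u∣′ → ⊥-elim (1+n≢n (trans (sym ∣u∣) ∣u∣′))) , (λ _ → proj₁ (∣∣-level walk) ∣v∣)

  Adj⇒hamming≤ : ∀ (x : Subset n) {u v} → Adj m u v → hamming x u ≤ suc (hamming x v)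
  Adj⇒hamming≤ x {u} {v} adj with Adj⇒⋖⊎⋗ adj
  ... | inj₁ u⋖v = m≡1+n⊎n≡1+m⇒m≤1+n (swap (Sum.map proj₂ proj₂ (⋖-split x u v u⋖v)))
  ... | inj₂ v⋖u = m≡1+n⊎n≡1+m⇒m≤1+n (Sum.map proj₂ proj₂ (⋖-split x v u v⋖u))

  Walk⇒hamming≤ : ∀ {u v : Subset n} {k} → Walk m u v k → hamming v u ≤ k
  Walk⇒hamming≤ {u = u} (here _) = ≤-reflexive (hamming-refl u)
  Walk⇒hamming≤ {v = v} (step adj walk) = ≤-trans (Adj⇒hamming≤ v adj) (s≤s (Walk⇒hamming≤ walk))

  hamming⇒Walk : ∀ {x : Subset n} → ∣ x ∣ ≡ m →
    ∀ k {v} → IsVertex m v → hamming x v ≡ k → Walk m x v k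
  hamming⇒Walk {x = x} ∣x∣ zero {v} _ h with hamming≡0⇒≡ x v h
  ... | refl = here (inj₁ ∣x∣)
  hamming⇒Walk {x = x} ∣x∣ (suc k) {v} (inj₁ ∣v∣) h with grow-towards x v
  ... | inj₁ x⊆v with p⊆q∧∣p∣≡∣q∣⇒p≡q x v x⊆v (trans ∣x∣ (sym ∣v∣))
  ...   | refl = ⊥-elim (1+n≢0 (trans (sym h) (hamming-refl x)))
  hamming⇒Walk ∣x∣ (suc k) (inj₁ ∣v∣) h | inj₂ (w , (v⊆w , ∣w∣≡) , h′) =
    Walk-snoc (hamming⇒Walk ∣x∣ k (inj₂ ∣w∣) (suc-injective (trans (sym h′) h))) (inj₂ (∣v∣ , ∣w∣ , v⊆w))
    where
    ∣w∣ : ∣ w ∣ ≡ suc m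
    ∣w∣ = trans ∣w∣≡ (cong suc ∣v∣)
  hamming⇒Walk {x = x} ∣x∣ (suc k) {v} (inj₂ ∣v∣) h with shrink-towards x v
  ... | inj₁ v⊆x = ⊥-elim (n≮n m (subst₂ _≤_ ∣v∣ ∣x∣ (p⊆q⇒∣p∣≤∣q∣ v⊆x)))
  ... | inj₂ (w , (w⊆v , ∣v∣≡) , h′) =
    Walk-snoc (hamming⇒Walk ∣x∣ k (inj₁ ∣w∣) (suc-injective (trans (sym h′) h))) (inj₁ (∣w∣ , ∣v∣ , w⊆v))
    where
    ∣w∣ : ∣ w ∣ ≡ m
    ∣w∣ = suc-injective (trans (sym ∣v∣≡) ∣v∣)

  Γ⇒hamming : ∀ {x v : Subset n} {k} → ∣ x ∣ ≡ m → Γ m k x v → hamming x v ≡ k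
  Γ⇒hamming {x = x} {v} {k} ∣x∣ (walk , shortest) = ≤-antisym
    (subst (_≤ k) (hamming-comm v x) (Walk⇒hamming≤ walk))
    (≮⇒≥ λ h<k → shortest _ h<k (hamming⇒Walk ∣x∣ _ (Walk⇒IsVertexʳ walk) refl))

  Γ⇒∣∣ : ∀ {x v : Subset n} {k} → ∣ x ∣ ≡ m → Γ m k x v → ∣ v ∣ ≡ level m k
  Γ⇒∣∣ ∣x∣ (walk , _) = proj₁ (∣∣-level walk) ∣x∣

  Γ-Adj⇒≤suc : ∀ {x u v : Subset n} {i j} → Γ m i x u → Γ m j x v → Adj m u v → j ≤ suc i
  Γ-Adj⇒≤suc (walk , _) (_ , shortest) adj = ≮⇒≥ λ 1+i<j → shortest _ 1+i<j (Walk-snoc walk adj)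

-- adjMat, idMat and inclMat are definitionally 𝟙 of their decision procedures.
𝟙 : ∀ {ℓ} {P : Set ℓ} → Dec P → ℕ
𝟙 P? = if does P? then 1 else 0

𝟙-no : ∀ {ℓ} {P : Set ℓ} (P? : Dec P) → ¬ P → 𝟙 P? ≡ 0
𝟙-no (yes p) ¬p = ⊥-elim (¬p p)
𝟙-no (no _) _ = refl

𝟙-⇔× : ∀ {ℓ} {P Q R : Set ℓ} (P? : Dec P) (Q? : Dec Q) (R? : Dec R) →
  P ⇔ (Q × R) → 𝟙 P? ≡ 𝟙 Q? * 𝟙 R?
𝟙-⇔× (yes _) (yes _) (yes _) _ = refl
𝟙-⇔× (yes p) (no ¬q) _ P⇔Q×R = ⊥-elim (¬q (proj₁ (Equivalence.to P⇔Q×R p)))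
𝟙-⇔× (yes p) (yes _) (no ¬r) P⇔Q×R = ⊥-elim (¬r (proj₂ (Equivalence.to P⇔Q×R p)))
𝟙-⇔× (no ¬p) (yes q) (yes r) P⇔Q×R = ⊥-elim (¬p (Equivalence.from P⇔Q×R (q , r)))
𝟙-⇔× (no _) (yes _) (no _) _ = refl
𝟙-⇔× (no _) (no _) _ _ = refl

module _ {m : ℕ} {x : Subset n} (∣x∣ : ∣ x ∣ ≡ m) where

  adjMat-Γ≡0 : ∀ {i j} {y z : Subset n} → i ≤ j → suc i ≢ j →
    Γ m i x y → Γ m j x z → adjMat m y z ≡ 0
  adjMat-Γ≡0 {i} {j} {y} {z} i≤j 1+i≢j Γy Γz = 𝟙-no (Adj? m y z) λ adj →
    let j≡i : j ≡ i
        j≡i = ≤-antisym (m<1+n⇒m≤n (≤∧≢⇒< (Γ-Adj⇒≤suc Γy Γz adj) (1+i≢j ∘ sym))) i≤j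
    in Adj⇒∣∣≢ adj (trans (Γ⇒∣∣ ∣x∣ Γy) (subst (λ k → level m k ≡ ∣ z ∣) j≡i (sym (Γ⇒∣∣ ∣x∣ Γz))))

  adjMat-Γ-even-odd : ∀ i {y z : Subset n} → Γ m (2 * i) x y → Γ m (2 * i + 1) x z →
    adjMat m y z ≡ (idMat ⊗ inclMat) (ident x y) (ident x z)
  adjMat-Γ-even-odd i {y} {z} Γy Γz =
    𝟙-⇔× (Adj? m y z) (≡-dec _≟B_ (y ∩ x) (z ∩ x)) (y ─ x ⊆? z ─ x)
      (⇔.trans (Adj⇔⊆ ∣y∣ ∣z∣) (⊆⇔∩≡×─⊆ x y z (trans ∣z∣ (cong suc (sym ∣y∣))) hz))
    where
    ∣y∣ : ∣ y ∣ ≡ m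
    ∣y∣ = trans (Γ⇒∣∣ ∣x∣ Γy) (level-2* m i)
    ∣z∣ : ∣ z ∣ ≡ suc m
    ∣z∣ = trans (Γ⇒∣∣ ∣x∣ Γz) (level-2*+ m i 1)
    hz : hamming x z ≡ suc (hamming x y)
    hz = trans (Γ⇒hamming ∣x∣ Γz) (trans (+-comm (2 * i) 1) (cong suc (sym (Γ⇒hamming ∣x∣ Γy))))

  adjMat-Γ-odd-even : ∀ i {y z : Subset n} → Γ m (2 * i + 1) x y → Γ m (2 * i + 2) x z →
    adjMat m y z ≡ ((inclMat ᵗ) ⊗ idMat) (ident x y) (ident x z)
  adjMat-Γ-odd-even i {y} {z} Γy Γz =
    𝟙-⇔× (Adj? m y z) (z ∩ x ⊆? y ∩ x) (≡-dec _≟B_ (y ─ x) (z ─ x))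
      (⇔.trans (Adj⇔⊇ ∣y∣ ∣z∣) (⊆⇔∩⊆×─≡ x z y (trans ∣y∣ (cong suc (sym ∣z∣))) hz))
    where
    ∣y∣ : ∣ y ∣ ≡ suc m
    ∣y∣ = trans (Γ⇒∣∣ ∣x∣ Γy) (level-2*+ m i 1)
    ∣z∣ : ∣ z ∣ ≡ m
    ∣z∣ = trans (Γ⇒∣∣ ∣x∣ Γz) (level-2*+ m i 2)
    hz : hamming x z ≡ suc (hamming x y)
    hz = trans (Γ⇒hamming ∣x∣ Γz) (trans (+-suc (2 * i) 1) (cong suc (sym (Γ⇒hamming ∣x∣ Γy))))

-- The bounds 1 ≤ m, i ≤ m and j ≤ 2m+1 only keep the layers nonempty.
lemma2p2 : (n m : ℕ) → 1 ≤ m → (x : Subset n) → ∣ x ∣ ≡ m →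
    ((i j : ℕ) → i ≤ j → j ≤ 2 * m + 1 → suc i ≢ j → (y z : Subset n) →
      Γ m i x y → Γ m j x z → adjMat m y z ≡ 0)
    × ((i : ℕ) → i ≤ m → (y z : Subset n) →
      Γ m (2 * i) x y → Γ m (2 * i + 1) x z →
      adjMat m y z ≡ (idMat ⊗ inclMat) (ident x y) (ident x z))
    × ((i : ℕ) → suc i ≤ m → (y z : Subset n) →
      Γ m (2 * i + 1) x y → Γ m (2 * i + 2) x z →
      adjMat m y z ≡ ((inclMat ᵗ) ⊗ idMat) (ident x y) (ident x z))
lemma2p2 n m _ x ∣x∣ =
  (λ i j i≤j _ 1+i≢j y z → adjMat-Γ≡0 ∣x∣ i≤j 1+i≢j) ,
  (λ i _ y z → adjMat-Γ-even-odd ∣x∣ i) ,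
  (λ i _ y z → adjMat-Γ-odd-even ∣x∣ i)
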